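{- Let $G=(V,E)$ be a finite simple graph and $P=(G,V_L,V_R)$ a position of Maker-Breaker Incidence, with $V_F=V\setminus(V_L\cup V_R)$. Let $v_1,v_2\in V_F$ be distinct free vertices such that $(N(v_1)\cap V_F)\setminus\{v_2\}=(N(v_2)\cap V_F)\setminus\{v_1\}$ and $|N(v_1)\cap V_L|=|N(v_2)\cap V_L|$. Then $Ls(P)=Ls(G,V_L\cup\{v_1\},V_R\cup\{v_2\})$ and $Rs(P)=Rs(G,V_L\cup\{v_1\},V_R\cup\{v_2\})$.
   Context: Maker-Breaker Incidence: Left (Maker) and Right (Breaker) alternately claim a not yet claimed vertex of $G$ until all vertices are claimed; the final score is the number of edges with both endpoints claimed by Left (Left maximizes, Right minimizes). A position $(G,V_L,V_R)$ has disjoint sets $V_L,V_R$ of vertices already claimed by Left and Right. Recursively, if $V_F\neq\emptyset$, $Ls(P)=\max_{x\in V_F}Rs(G,V_L\cup\{x\},V_R)$ and $Rs(P)=\min_{x\in V_F}Ls(G,V_L,V_R\cup\{x\})$; if $V_F=\emptyset$ both equal the number of edges contained in $V_L$. $N(v)$ denotes the neighborhood of $v$. -}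

module Defs where

open import Data.Nat using (ℕ; zero; suc; _+_; _⊔_; _⊓_; _<ᵇ_)
open import Data.Bool using (Bool; true; false; _∧_) renaming (_≟_ to _≟ᵇ_)
open import Data.Fin using (Fin; toℕ; _≟_)
open import Data.List using (List; []; _∷_; foldr; filter; length; map; allFin)
open import Data.Nat.ListAction using (sum)
open import Relation.Nullary using (yes; no; ¬_)
open import Relation.Binary.PropositionalEquality using (_≡_)

record SimpleGraph (n : ℕ) : Set where
  field
    adj   : Fin n → Fin n → Bool
    sym   : ∀ u v → adj u v ≡ adj v u
    irrfl : ∀ v → adj v v ≡ false
open SimpleGraph public

data Owner : Set where
  L R F : Owner

isL : Owner → Bool
isL L = true
isL _ = false

isF : Owner → Bool
isF F = true
isF _ = false

-- A position (G, V_L, V_R) is encoded by the graph and the colouring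
-- c : V → Owner  (V_L = c⁻¹ L, V_R = c⁻¹ R, V_F = c⁻¹ F); disjointness of
-- V_L and V_R is automatic.
Colouring : ℕ → Set
Colouring n = Fin n → Owner

claim : ∀ {n} → Fin n → Owner → Colouring n → Colouring n
claim x o c y with y ≟ x
... | yes _ = o
... | no  _ = c y

b2n : Bool → ℕ
b2n true  = 1
b2n false = 0

freeList : ∀ {n} → Colouring n → List (Fin n)
freeList {n} c = filter (λ v → isF (c v) ≟ᵇ true) (allFin n)

numFree : ∀ {n} → Colouring n → ℕ
numFree c = length (freeList c)

edgesInL : ∀ {n} → SimpleGraph n → Colouring n → ℕ
edgesInL {n} G c =
  sum (map (λ u → sum (map (λ v →
        b2n ((toℕ u <ᵇ toℕ v) ∧ adj G u v ∧ isL (c u) ∧ isL (c v)))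
      (allFin n))) (allFin n))

maxOver : ∀ {A : Set} → (A → ℕ) → A → List A → ℕ
maxOver f x xs = foldr (λ y acc → f y ⊔ acc) (f x) xs

minOver : ∀ {A : Set} → (A → ℕ) → A → List A → ℕ
minOver f x xs = foldr (λ y acc → f y ⊓ acc) (f x) xs

-- Ls' k / Rs' k : game values, by recursion on a counter k which is
-- always instantiated with the number of free vertices.
mutual
  Ls' : ∀ {n} → ℕ → SimpleGraph n → Colouring n → ℕ
  Ls' zero    G c = edgesInL G c
  Ls' (suc k) G c with freeList c
  ... | []     = edgesInL G c
  ... | x ∷ xs = maxOver (λ y → Rs' k G (claim y L c)) x xs

  Rs' : ∀ {n} → ℕ → SimpleGraph n → Colouring n → ℕ
  Rs' zero    G c = edgesInL G c
  Rs' (suc k) G c with freeList c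
  ... | []     = edgesInL G c
  ... | x ∷ xs = minOver (λ y → Ls' k G (claim y R c)) x xs

Ls : ∀ {n} → SimpleGraph n → Colouring n → ℕ
Ls G c = Ls' (numFree c) G c

Rs : ∀ {n} → SimpleGraph n → Colouring n → ℕ
Rs G c = Rs' (numFree c) G c

degL : ∀ {n} → SimpleGraph n → Colouring n → Fin n → ℕ
degL {n} G c v = sum (map (λ u → b2n (adj G v u ∧ isL (c u))) (allFin n))

-- Call the free vertices v₁, v₂ twins if they have the same free neighbours apart from each
-- other and the same number of Left neighbours. Giving one twin to Left and the other to Right
-- adds the same number of Left edges whichever way round it is done, and claiming any third
-- vertex keeps v₁, v₂ twins; so by induction on the number of free vertices the two splittings
-- of the pair have the same game values. The theorem follows by the same induction: a move on
-- one twin is answered by the other one (the swap makes the order irrelevant), every other move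
-- commutes with splitting the pair, and when the twins are the last free vertices the answer is
-- forced.

module Submission where

open import Defs hiding (sym)
open import Data.Nat using (ℕ; zero; suc; _+_; _*_; _≤_; _<_; _<ᵇ_)
open import Data.Nat.Properties
  using ( module ≤-Reasoning; +-*-semiring; +-identityʳ; +-comm; suc-injective
        ; ≤-refl; ≤-reflexive; ≤-antisym; ≤-trans; m≤n⊔m; m≤m⊔n; ⊔-lub; m⊓n≤n; m⊓n≤m; ⊓-glb
        ; <ᵇ⇒<; <⇒<ᵇ; <⇒≯; ≮⇒≥ )
open import Data.Nat.Tactic.RingSolver using (solve-∀)
import Data.Nat.ListAction as List
open import Data.Bool using (true; false; _∧_; T)
open import Data.Bool.Properties using (∧-identityʳ; ∧-zeroʳ; ⇔→≡) renaming (_≟_ to _≟ᵇ_)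
open import Data.Fin using (Fin; toℕ; _≟_; punchIn) renaming (zero to fzero; suc to fsuc)
open import Data.Fin.Properties using (punchInᵢ≢i; toℕ-injective; any?)
open import Data.Vec.Functional using (removeAt)
open import Data.List using (List; []; _∷_; map; filter; length; allFin; tabulate)
open import Data.List.Properties using (map-tabulate; map-cong)
open import Data.List.Membership.Propositional using (_∈_)
open import Data.List.Relation.Unary.Any using (here; there)
open import Data.List.Membership.Propositional.Properties using (∈-filter⁻; ∈-filter⁺; ∈-allFin)
open import Data.Product using (_×_; _,_; proj₁; proj₂; ∃)
open import Function using (_∘_)
open import Function.Bundles using (_⇔_; mk⇔; Equivalence)
open import Relation.Unary using (Decidable)
open import Relation.Nullary using (Dec; yes; no; ¬_; does; contradiction)
open import Relation.Binary.PropositionalEquality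
open import Algebra.Properties.Semiring.Sum +-*-semiring
  using (∑-distrib-+; sum-cong-≗; sum-remove; *-distribˡ-sum; sum-replicate-zero)
  renaming (sum to ∑)

private variable
  n : ℕ

-- Finite sums

listSum-allFin : (f : Fin n → ℕ) → List.sum (map f (allFin n)) ≡ ∑ f
listSum-allFin f = trans (cong List.sum (map-tabulate (λ i → i) f)) (listSum-tabulate f)
  where
  listSum-tabulate : ∀ {n} (f : Fin n → ℕ) → List.sum (tabulate f) ≡ ∑ f
  listSum-tabulate {zero}  f = refl
  listSum-tabulate {suc n} f = cong (f fzero +_) (listSum-tabulate (f ∘ fsuc))

length-filter≡listSum : ∀ {A : Set} {P : A → Set} (P? : Decidable P) (xs : List A) →
  length (filter P? xs) ≡ List.sum (map (b2n ∘ does ∘ P?) xs)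
length-filter≡listSum P? []       = refl
length-filter≡listSum P? (x ∷ xs) with does (P? x)
... | true  = cong suc (length-filter≡listSum P? xs)
... | false = length-filter≡listSum P? xs

∑-update : (f g : Fin n → ℕ) (y : Fin n) → (∀ v → v ≢ y → f v ≡ g v) →
           ∑ f + g y ≡ ∑ g + f y
∑-update {suc n} f g y f≡g = begin
  ∑ f + g y                     ≡⟨ cong (_+ g y) (sum-remove {i = y} f) ⟩
  f y + ∑ (removeAt f y) + g y  ≡⟨ cong (λ r → f y + r + g y) rest ⟩
  f y + ∑ (removeAt g y) + g y  ≡⟨ swap (f y) _ (g y) ⟩
  g y + ∑ (removeAt g y) + f y  ≡⟨ cong (_+ f y) (sum-remove {i = y} g) ⟨
  ∑ g + f y                     ∎
  where
  open ≡-Reasoning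
  rest : ∑ (removeAt f y) ≡ ∑ (removeAt g y)
  rest = sum-cong-≗ (λ i → f≡g (punchIn y i) (punchInᵢ≢i y i))
  swap : ∀ a r b → a + r + b ≡ b + r + a
  swap = solve-∀

δ : Fin n → Fin n → ℕ
δ u x = b2n (does (u ≟ x))

∑-δ : (x : Fin n) (a : Fin n → ℕ) → ∑ (λ v → δ v x * a v) ≡ a x
∑-δ {n} x a = begin
  ∑ (λ v → δ v x * a v)        ≡⟨ +-identityʳ _ ⟨
  ∑ (λ v → δ v x * a v) + 0    ≡⟨ ∑-update _ (λ _ → 0) x off-x ⟩
  ∑ {n} (λ _ → 0) + δ x x * a x ≡⟨ cong₂ _+_ (sum-replicate-zero n) (at-x (x ≟ x)) ⟩
  a x                          ∎
  where
  open ≡-Reasoning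
  off-x : ∀ v → v ≢ x → δ v x * a v ≡ 0
  off-x v v≢x with v ≟ x
  ... | yes v≡x = contradiction v≡x v≢x
  ... | no  _   = refl
  at-x : ∀ d → b2n (does d) * a x ≡ a x
  at-x (yes _) = +-identityʳ (a x)
  at-x (no x≢x) = contradiction refl x≢x

-- Claiming vertices

private variable
  c d e : Colouring n
  x y : Fin n
  o : Owner

claim-self : (y : Fin n) (o : Owner) (c : Colouring n) → claim y o c y ≡ o
claim-self y o c with y ≟ y
... | yes _   = refl
... | no  y≢y = contradiction refl y≢y

claim-other : ∀ {v} (o : Owner) (c : Colouring n) → v ≢ y → claim y o c v ≡ c v
claim-other {y = y} {v} o c v≢y with v ≟ y
... | yes v≡y = contradiction v≡y v≢y
... | no  _   = refl

claim-cong : c ≗ d → claim y o c ≗ claim y o d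
claim-cong {y = y} c≗d v with v ≟ y
... | yes _ = refl
... | no  _ = c≗d v

claim-comm : ∀ {a b : Fin n} p q (c : Colouring n) → a ≢ b →
             claim a p (claim b q c) ≗ claim b q (claim a p c)
claim-comm {a = a} {b} p q c a≢b v = by-cases (v ≟ a) (v ≟ b)
  where
  by-cases : Dec (v ≡ a) → Dec (v ≡ b) → claim a p (claim b q c) v ≡ claim b q (claim a p c) v
  by-cases (yes refl) (yes refl) = contradiction refl a≢b
  by-cases (yes refl) (no v≢b)   =
    trans (claim-self v p _) (sym (trans (claim-other q _ v≢b) (claim-self v p c)))
  by-cases (no v≢a)   (yes refl) =
    trans (claim-other p _ v≢a) (trans (claim-self v q c) (sym (claim-self v q _)))
  by-cases (no v≢a)   (no v≢b)   =
    trans (claim-other p _ v≢a) (trans (claim-other q c v≢b)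
      (sym (trans (claim-other q _ v≢b) (claim-other p c v≢a))))

claim-comm₂ : ∀ {a b : Fin n} p q (c : Colouring n) → y ≢ a → y ≢ b →
              claim y o (claim b q (claim a p c)) ≗ claim b q (claim a p (claim y o c))
claim-comm₂ {o = o} p q c y≢a y≢b v =
  trans (claim-comm o q _ y≢b v) (claim-cong (claim-comm o p c y≢a) v)

claim-free⁺ : ∀ {v} → c v ≡ F → v ≢ y → claim y o c v ≡ F
claim-free⁺ {c = c} {o = o} cv v≢y = trans (claim-other o c v≢y) cv

claim-free⁻ : (c : Colouring n) (y : Fin n) {v : Fin n} →
              claim y o c v ≡ F → o ≢ F → v ≢ y × c v ≡ F
claim-free⁻ c y {v} free o≢F with v ≟ y
... | yes _   = contradiction free o≢F
... | no  v≢y = v≢y , free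

isF≡true⇒F : isF o ≡ true → o ≡ F
isF≡true⇒F {F} _ = refl

isF-claimed : o ≢ F → isF o ≡ false
isF-claimed {L} _   = refl
isF-claimed {R} _   = refl
isF-claimed {F} F≢F = contradiction refl F≢F

L≢F : L ≢ F
L≢F ()

R≢F : R ≢ F
R≢F ()

free? : (o : Owner) → Dec (o ≡ F)
free? L = no λ ()
free? R = no λ ()
free? F = yes refl

free-transfer : (∀ v → isF (c v) ≡ isF (d v)) → ∀ {v} → c v ≡ F → d v ≡ F
free-transfer same {v} cv≡F = isF≡true⇒F (trans (sym (same v)) (cong isF cv≡F))

freeList⁻ : ∀ {v} → v ∈ freeList c → c v ≡ F
freeList⁻ {n} {c} v∈ = isF≡true⇒F (proj₂ (∈-filter⁻ (λ v → isF (c v) ≟ᵇ true) {xs = allFin n} v∈))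

freeList⁺ : ∀ {v} → c v ≡ F → v ∈ freeList c
freeList⁺ {c = c} {v} cv≡F = ∈-filter⁺ (λ v → isF (c v) ≟ᵇ true) (∈-allFin v) (cong isF cv≡F)

numFree≡∑ : (c : Colouring n) → numFree c ≡ ∑ (λ v → b2n (isF (c v)))
numFree≡∑ {n} c = begin
  numFree c
    ≡⟨ length-filter≡listSum _ (allFin n) ⟩
  List.sum (map (λ v → b2n (does (isF (c v) ≟ᵇ true))) (allFin n))
    ≡⟨ cong List.sum (map-cong (λ v → cong b2n (does-≟true (isF (c v)))) (allFin n)) ⟩
  List.sum (map (λ v → b2n (isF (c v))) (allFin n))
    ≡⟨ listSum-allFin (λ v → b2n (isF (c v))) ⟩
  ∑ (λ v → b2n (isF (c v)))
    ∎
  where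
  open ≡-Reasoning
  does-≟true : ∀ b → does (b ≟ᵇ true) ≡ b
  does-≟true true  = refl
  does-≟true false = refl

numFree-claim : (c : Colouring n) (y : Fin n) → c y ≡ F → o ≢ F →
                numFree c ≡ suc (numFree (claim y o c))
numFree-claim {o = o} c y cy≡F o≢F = begin
  numFree c                            ≡⟨ numFree≡∑ c ⟩
  ∑ free                               ≡⟨ +-identityʳ _ ⟨
  ∑ free + 0                           ≡⟨ cong (λ b → ∑ free + b2n b) (isF-claimed o≢F) ⟨
  ∑ free + b2n (isF o)                 ≡⟨ cong (∑ free +_) (cong (b2n ∘ isF) (claim-self y o c)) ⟨
  ∑ free + free′ y                     ≡⟨ ∑-update free free′ y unchanged ⟩
  ∑ free′ + free y                     ≡⟨ cong (λ o → ∑ free′ + b2n (isF o)) cy≡F ⟩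
  ∑ free′ + 1                          ≡⟨ +-comm _ 1 ⟩
  suc (∑ free′)                        ≡⟨ cong suc (numFree≡∑ (claim y o c)) ⟨
  suc (numFree (claim y o c))          ∎
  where
  open ≡-Reasoning
  free free′ : Fin _ → ℕ
  free  v = b2n (isF (c v))
  free′ v = b2n (isF (claim y o c v))
  unchanged : ∀ v → v ≢ y → free v ≡ free′ v
  unchanged v v≢y = cong (b2n ∘ isF) (sym (claim-other o c v≢y))

claim-induction : (P : Colouring n → Set) →
                  (∀ c → (∀ y o → c y ≡ F → o ≢ F → P (claim y o c)) → P c) →
                  ∀ c → P c
claim-induction P step c = by-count (numFree c) c refl
  where
  by-count : ∀ k c → numFree c ≡ k → P c
  by-count zero    c count = step c λ y o cy o≢F →
    contradiction (trans (sym count) (numFree-claim c y cy o≢F)) λ ()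
  by-count (suc k) c count = step c λ y o cy o≢F →
    by-count k (claim y o c) (suc-injective (trans (sym (numFree-claim c y cy o≢F)) count))

-- Left edges and Left degrees

isL-claimR : isL (c y) ≡ false → ∀ v → isL (claim y R c v) ≡ isL (c v)
isL-claimR {y = y} cy v with v ≟ y
... | yes refl = sym cy
... | no  _    = refl

n<ᵇn≡false : ∀ m → (m <ᵇ m) ≡ false
n<ᵇn≡false zero          = refl
n<ᵇn≡false (suc zero)    = refl
n<ᵇn≡false (suc (suc m)) = n<ᵇn≡false (suc m)

<ᵇ≡true⇒< : ∀ {m k} → (m <ᵇ k) ≡ true → m < k
<ᵇ≡true⇒< {m} {k} eq = <ᵇ⇒< m k (subst T (sym eq) _)

<ᵇ≡false⇒≮ : ∀ {m k} → (m <ᵇ k) ≡ false → ¬ m < k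
<ᵇ≡false⇒≮ eq m<k = subst T eq (<⇒<ᵇ m<k)

module Counting (G : SimpleGraph n) where

  degL-cong : (∀ v → isL (c v) ≡ isL (d v)) → degL G c x ≡ degL G d x
  degL-cong {x = x} same =
    cong List.sum (map-cong (λ u → cong (λ b → b2n (adj G x u ∧ b)) (same u)) (allFin _))

  degL-claimR : c y ≡ F → degL G (claim y R c) x ≡ degL G c x
  degL-claimR cy≡F = degL-cong (isL-claimR (cong isL cy≡F))

  degL-claimL : c y ≡ F → degL G (claim y L c) x ≡ degL G c x + b2n (adj G x y)
  degL-claimL {c = c} {y} {x} cy≡F = begin
    degL G (claim y L c) x               ≡⟨ listSum-allFin row′ ⟩
    ∑ row′                               ≡⟨ +-identityʳ _ ⟨
    ∑ row′ + 0                           ≡⟨ cong (λ b → ∑ row′ + b2n b) (∧-zeroʳ (adj G x y)) ⟨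
    ∑ row′ + b2n (adj G x y ∧ false)     ≡⟨ cong (λ o → ∑ row′ + b2n (adj G x y ∧ isL o)) cy≡F ⟨
    ∑ row′ + row y                       ≡⟨ ∑-update row′ row y unchanged ⟩
    ∑ row + row′ y                       ≡⟨ cong₂ (λ s o → s + b2n (adj G x y ∧ isL o))
                                                  (sym (listSum-allFin row)) (claim-self y L c) ⟩
    degL G c x + b2n (adj G x y ∧ true)  ≡⟨ cong (λ b → degL G c x + b2n b) (∧-identityʳ _) ⟩
    degL G c x + b2n (adj G x y)         ∎
    where
    open ≡-Reasoning
    row row′ : Fin _ → ℕ
    row  u = b2n (adj G x u ∧ isL (c u))
    row′ u = b2n (adj G x u ∧ isL (claim y L c u))
    unchanged : ∀ u → u ≢ y → row′ u ≡ row u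
    unchanged u u≢y = cong (λ o → b2n (adj G x u ∧ isL o)) (claim-other L c u≢y)

  edge : Colouring n → Fin n → Fin n → ℕ
  edge c u v = b2n ((toℕ u <ᵇ toℕ v) ∧ adj G u v ∧ isL (c u) ∧ isL (c v))

  edgesInL≡∑ : (c : Colouring n) → edgesInL G c ≡ ∑ (λ u → ∑ (edge c u))
  edgesInL≡∑ c = trans (cong List.sum (map-cong (λ u → listSum-allFin (edge c u)) (allFin n)))
                       (listSum-allFin (λ u → ∑ (edge c u)))

  edgesInL-cong : (∀ v → isL (c v) ≡ isL (d v)) → edgesInL G c ≡ edgesInL G d
  edgesInL-cong {c = c} {d} same = begin
    edgesInL G c             ≡⟨ edgesInL≡∑ c ⟩
    ∑ (λ u → ∑ (edge c u))   ≡⟨ sum-cong-≗ (λ u → sum-cong-≗ (λ v → same-edge u v)) ⟩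
    ∑ (λ u → ∑ (edge d u))   ≡⟨ edgesInL≡∑ d ⟨
    edgesInL G d             ∎
    where
    open ≡-Reasoning
    same-edge : ∀ u v → edge c u v ≡ edge d u v
    same-edge u v rewrite same u | same v = refl

  edgesInL-claimR : c y ≡ F → edgesInL G (claim y R c) ≡ edgesInL G c
  edgesInL-claimR cy≡F = edgesInL-cong (isL-claimR (cong isL cy≡F))

  module _ (c : Colouring n) (x : Fin n) (cx : isL (c x) ≡ false) where
    private
      -- The Left edges gained by claiming x, towards larger and towards smaller vertices.
      up down : Fin n → ℕ
      up   v = b2n ((toℕ x <ᵇ toℕ v) ∧ adj G x v ∧ isL (c v))
      down u = b2n ((toℕ u <ᵇ toℕ x) ∧ adj G u x ∧ isL (c u))

      -- The right-hand sides are those of edge-claimL with δ evaluated at u ≡ x, resp. v ≡ x.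
      gain-first : ∀ a b d →
        b2n (a ∧ b ∧ true ∧ d) ≡ b2n (a ∧ b ∧ false ∧ d) + (b2n (a ∧ b ∧ d) + 0 + 0)
      gain-first true  true  true  = refl
      gain-first true  true  false = refl
      gain-first true  false d     = refl
      gain-first false b     d     = refl

      gain-second : ∀ a b d →
        b2n (a ∧ b ∧ d ∧ true) ≡ b2n (a ∧ b ∧ d ∧ false) + (0 + (b2n (a ∧ b ∧ d) + 0))
      gain-second true  true  true  = refl
      gain-second true  true  false = refl
      gain-second true  false d     = refl
      gain-second false b     d     = refl

      edge-claimL : ∀ u v → edge (claim x L c) u v ≡ edge c u v + (δ u x * up v + δ v x * down u)
      edge-claimL u v with u ≟ x | v ≟ x
      ... | yes refl | yes refl rewrite n<ᵇn≡false (toℕ x) = refl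
      ... | yes refl | no _     rewrite cx = gain-first  (toℕ u <ᵇ toℕ v) (adj G u v) (isL (c v))
      ... | no _     | yes refl rewrite cx = gain-second (toℕ u <ᵇ toℕ v) (adj G u v) (isL (c u))
      ... | no _     | no _     = sym (+-identityʳ _)

      up+down : ∀ u → up u + down u ≡ b2n (adj G x u ∧ isL (c u))
      up+down u rewrite SimpleGraph.sym G u x with toℕ x <ᵇ toℕ u in x<u | toℕ u <ᵇ toℕ x in u<x
      ... | true  | true  = contradiction (<ᵇ≡true⇒< {toℕ x} x<u) (<⇒≯ (<ᵇ≡true⇒< {toℕ u} u<x))
      ... | true  | false = +-identityʳ _
      ... | false | true  = refl
      ... | false | false =
        cong (λ b → b2n (b ∧ isL (c u))) (sym (trans (cong (λ w → adj G w u) x≡u) (irrfl G u)))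
        where
        x≡u : x ≡ u
        x≡u = toℕ-injective (≤-antisym (≮⇒≥ (<ᵇ≡false⇒≮ {toℕ u} u<x))
                                       (≮⇒≥ (<ᵇ≡false⇒≮ {toℕ x} x<u)))

      row-claimL : ∀ u → ∑ (λ v → edge c u v + (δ u x * up v + δ v x * down u))
                         ≡ ∑ (edge c u) + (δ u x * ∑ up + down u)
      row-claimL u = begin
        ∑ (λ v → edge c u v + (δ u x * up v + δ v x * down u))
          ≡⟨ ∑-distrib-+ (edge c u) _ ⟩
        ∑ (edge c u) + ∑ (λ v → δ u x * up v + δ v x * down u)
          ≡⟨ cong (∑ (edge c u) +_) (∑-distrib-+ (λ v → δ u x * up v) (λ v → δ v x * down u)) ⟩
        ∑ (edge c u) + (∑ (λ v → δ u x * up v) + ∑ (λ v → δ v x * down u))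
          ≡⟨ cong (λ s → ∑ (edge c u) + (s + ∑ (λ v → δ v x * down u)))
                  (*-distribˡ-sum (δ u x) up) ⟨
        ∑ (edge c u) + (δ u x * ∑ up + ∑ (λ v → δ v x * down u))
          ≡⟨ cong (λ s → ∑ (edge c u) + (δ u x * ∑ up + s)) (∑-δ x (λ _ → down u)) ⟩
        ∑ (edge c u) + (δ u x * ∑ up + down u) ∎
        where open ≡-Reasoning

    edgesInL-claimL : edgesInL G (claim x L c) ≡ edgesInL G c + degL G c x
    edgesInL-claimL = begin
      edgesInL G (claim x L c)
        ≡⟨ edgesInL≡∑ (claim x L c) ⟩
      ∑ (λ u → ∑ (edge (claim x L c) u))
        ≡⟨ sum-cong-≗ (λ u → trans (sum-cong-≗ (edge-claimL u)) (row-claimL u)) ⟩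
      ∑ (λ u → ∑ (edge c u) + (δ u x * ∑ up + down u))
        ≡⟨ ∑-distrib-+ (λ u → ∑ (edge c u)) _ ⟩
      ∑ (λ u → ∑ (edge c u)) + ∑ (λ u → δ u x * ∑ up + down u)
        ≡⟨ cong₂ _+_ (sym (edgesInL≡∑ c)) (∑-distrib-+ (λ u → δ u x * ∑ up) down) ⟩
      edgesInL G c + (∑ (λ u → δ u x * ∑ up) + ∑ down)
        ≡⟨ cong (λ s → edgesInL G c + (s + ∑ down)) (∑-δ x (λ _ → ∑ up)) ⟩
      edgesInL G c + (∑ up + ∑ down)
        ≡⟨ cong (edgesInL G c +_) (∑-distrib-+ up down) ⟨
      edgesInL G c + ∑ (λ u → up u + down u)
        ≡⟨ cong (edgesInL G c +_) (sum-cong-≗ up+down) ⟩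
      edgesInL G c + ∑ (λ u → b2n (adj G x u ∧ isL (c u)))
        ≡⟨ cong (edgesInL G c +_) (listSum-allFin (λ u → b2n (adj G x u ∧ isL (c u)))) ⟨
      edgesInL G c + degL G c x ∎
      where open ≡-Reasoning

-- Game values

module _ {A : Set} (f : A → ℕ) where

  maxOver-ub : ∀ {y} x xs → y ∈ x ∷ xs → f y ≤ maxOver f x xs
  maxOver-ub x []       (here refl)         = ≤-refl
  maxOver-ub x (z ∷ zs) (here refl)         = ≤-trans (maxOver-ub x zs (here refl)) (m≤n⊔m (f z) _)
  maxOver-ub x (z ∷ zs) (there (here refl)) = m≤m⊔n (f z) _
  maxOver-ub x (z ∷ zs) (there (there y∈))  = ≤-trans (maxOver-ub x zs (there y∈)) (m≤n⊔m (f z) _)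

  maxOver-lub : ∀ {T} x xs → (∀ y → y ∈ x ∷ xs → f y ≤ T) → maxOver f x xs ≤ T
  maxOver-lub x []       bound = bound x (here refl)
  maxOver-lub x (z ∷ zs) bound = ⊔-lub (bound z (there (here refl)))
    (maxOver-lub x zs λ { y (here y≡x) → bound y (here y≡x)
                        ; y (there y∈) → bound y (there (there y∈)) })

  minOver-lb : ∀ {y} x xs → y ∈ x ∷ xs → minOver f x xs ≤ f y
  minOver-lb x []       (here refl)         = ≤-refl
  minOver-lb x (z ∷ zs) (here refl)         = ≤-trans (m⊓n≤n (f z) _) (minOver-lb x zs (here refl))
  minOver-lb x (z ∷ zs) (there (here refl)) = m⊓n≤m (f z) _
  minOver-lb x (z ∷ zs) (there (there y∈))  = ≤-trans (m⊓n≤n (f z) _) (minOver-lb x zs (there y∈))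

  minOver-glb : ∀ {T} x xs → (∀ y → y ∈ x ∷ xs → T ≤ f y) → T ≤ minOver f x xs
  minOver-glb x []       bound = bound x (here refl)
  minOver-glb x (z ∷ zs) bound = ⊓-glb (bound z (there (here refl)))
    (minOver-glb x zs λ { y (here y≡x) → bound y (here y≡x)
                        ; y (there y∈) → bound y (there (there y∈)) })

module GameValues (G : SimpleGraph n) where

  open Counting G using (edgesInL-cong)

  Ls'-ub : ∀ k → y ∈ freeList c → Rs' k G (claim y L c) ≤ Ls' (suc k) G c
  Ls'-ub {c = c} k y∈ with freeList c
  ... | x ∷ xs = maxOver-ub (λ z → Rs' k G (claim z L c)) x xs y∈

  Ls'-lub : ∀ k {T} → y ∈ freeList c → (∀ z → z ∈ freeList c → Rs' k G (claim z L c) ≤ T) →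
            Ls' (suc k) G c ≤ T
  Ls'-lub {c = c} k y∈ bound with freeList c
  ... | x ∷ xs = maxOver-lub (λ z → Rs' k G (claim z L c)) x xs bound

  Rs'-lb : ∀ k → y ∈ freeList c → Rs' (suc k) G c ≤ Ls' k G (claim y R c)
  Rs'-lb {c = c} k y∈ with freeList c
  ... | x ∷ xs = minOver-lb (λ z → Ls' k G (claim z R c)) x xs y∈

  Rs'-glb : ∀ k {T} → y ∈ freeList c → (∀ z → z ∈ freeList c → T ≤ Ls' k G (claim z R c)) →
            T ≤ Rs' (suc k) G c
  Rs'-glb {c = c} k y∈ bound with freeList c
  ... | x ∷ xs = minOver-glb (λ z → Ls' k G (claim z R c)) x xs bound

  private
    numFree-moves : ∀ (c : Colouring n) y x → c y ≡ F → c x ≡ F → o ≢ F →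
                    numFree (claim x o c) ≡ numFree (claim y o c)
    numFree-moves c y x cy cx o≢F =
      suc-injective (trans (sym (numFree-claim c x cx o≢F)) (numFree-claim c y cy o≢F))

  Ls-ub : c y ≡ F → Rs G (claim y L c) ≤ Ls G c
  Ls-ub {c = c} {y} cy = subst (λ m → Rs G (claim y L c) ≤ Ls' m G c)
                               (sym (numFree-claim c y cy L≢F)) (Ls'-ub _ (freeList⁺ cy))

  Ls-lub : ∀ {T} → c y ≡ F → (∀ z → c z ≡ F → Rs G (claim z L c) ≤ T) → Ls G c ≤ T
  Ls-lub {c = c} {y} {T} cy bound =
    subst (λ m → Ls' m G c ≤ T) (sym (numFree-claim c y cy L≢F)) (Ls'-lub _ (freeList⁺ cy) move)
    where
    move : ∀ z → z ∈ freeList c → Rs' (numFree (claim y L c)) G (claim z L c) ≤ T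
    move z z∈ = subst (λ m → Rs' m G (claim z L c) ≤ T) (numFree-moves c y z cy (freeList⁻ z∈) L≢F)
                      (bound z (freeList⁻ z∈))

  Rs-lb : c y ≡ F → Rs G c ≤ Ls G (claim y R c)
  Rs-lb {c = c} {y} cy = subst (λ m → Rs' m G c ≤ Ls G (claim y R c))
                               (sym (numFree-claim c y cy R≢F)) (Rs'-lb _ (freeList⁺ cy))

  Rs-glb : ∀ {T} → c y ≡ F → (∀ z → c z ≡ F → T ≤ Ls G (claim z R c)) → T ≤ Rs G c
  Rs-glb {c = c} {y} {T} cy bound =
    subst (λ m → T ≤ Rs' m G c) (sym (numFree-claim c y cy R≢F)) (Rs'-glb _ (freeList⁺ cy) move)
    where
    move : ∀ z → z ∈ freeList c → T ≤ Ls' (numFree (claim y R c)) G (claim z R c)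
    move z z∈ = subst (λ m → T ≤ Ls' m G (claim z R c)) (numFree-moves c y z cy (freeList⁻ z∈) R≢F)
                      (bound z (freeList⁻ z∈))

  Ls-terminal : (∀ z → c z ≢ F) → Ls G c ≡ edgesInL G c
  Ls-terminal {c = c} none with freeList c | freeList⁻ {c = c}
  ... | []     | _  = refl
  ... | x ∷ xs | x∈ = contradiction (x∈ (here refl)) (none x)

  Rs-terminal : (∀ z → c z ≢ F) → Rs G c ≡ edgesInL G c
  Rs-terminal {c = c} none with freeList c | freeList⁻ {c = c}
  ... | []     | _  = refl
  ... | x ∷ xs | x∈ = contradiction (x∈ (here refl)) (none x)

  SameValues : Colouring n → Colouring n → Set
  SameValues c d = Ls G c ≡ Ls G d × Rs G c ≡ Rs G d

  values-cong : (∀ v → isF (c v) ≡ isF (d v)) → edgesInL G c ≡ edgesInL G d →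
                (∀ y o → c y ≡ F → o ≢ F → SameValues (claim y o c) (claim y o d)) →
                SameValues c d
  values-cong {c = c} {d} same-free same-edges moves with any? (λ y → free? (c y))
  ... | yes (y , cy) =
        ≤-antisym
          (Ls-lub cy λ z cz → ≤-trans (≤-reflexive (Rs-moveL cz)) (Ls-ub (c⇒d cz)))
          (Ls-lub (c⇒d cy) λ z dz → ≤-trans (≤-reflexive (sym (Rs-moveL (d⇒c dz)))) (Ls-ub (d⇒c dz)))
      , ≤-antisym
          (Rs-glb (c⇒d cy) λ z dz → ≤-trans (Rs-lb (d⇒c dz)) (≤-reflexive (Ls-moveR (d⇒c dz))))
          (Rs-glb cy λ z cz → ≤-trans (Rs-lb (c⇒d cz)) (≤-reflexive (sym (Ls-moveR cz))))
    where
    c⇒d : ∀ {v} → c v ≡ F → d v ≡ F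
    c⇒d = free-transfer same-free
    d⇒c : ∀ {v} → d v ≡ F → c v ≡ F
    d⇒c = free-transfer (sym ∘ same-free)
    Rs-moveL : ∀ {z} → c z ≡ F → Rs G (claim z L c) ≡ Rs G (claim z L d)
    Rs-moveL {z} cz = proj₂ (moves z L cz L≢F)
    Ls-moveR : ∀ {z} → c z ≡ F → Ls G (claim z R c) ≡ Ls G (claim z R d)
    Ls-moveR {z} cz = proj₁ (moves z R cz R≢F)
  ... | no none = trans (Ls-terminal c-over) (trans same-edges (sym (Ls-terminal d-over)))
                , trans (Rs-terminal c-over) (trans same-edges (sym (Rs-terminal d-over)))
    where
    c-over : ∀ z → c z ≢ F
    c-over z cz = none (z , cz)
    d-over : ∀ z → d z ≢ F
    d-over z dz = none (z , free-transfer (sym ∘ same-free) dz)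

  SameValues-sym : SameValues c d → SameValues d c
  SameValues-sym (Ls≡ , Rs≡) = sym Ls≡ , sym Rs≡

  SameValues-trans : SameValues c d → SameValues d e → SameValues c e
  SameValues-trans (Ls≡ , Rs≡) (Ls≡′ , Rs≡′) = trans Ls≡ Ls≡′ , trans Rs≡ Rs≡′

  values-ext : c ≗ d → SameValues c d
  values-ext {c = c} = claim-induction (λ c → ∀ {d} → c ≗ d → SameValues c d) step c
    where
    step : ∀ c → (∀ y o → c y ≡ F → o ≢ F → ∀ {d} → claim y o c ≗ d → SameValues (claim y o c) d) →
           ∀ {d} → c ≗ d → SameValues c d
    step c ih c≗d = values-cong (cong isF ∘ c≗d) (edgesInL-cong (cong isL ∘ c≗d))
                                (λ y o cy o≢F → ih y o cy o≢F (claim-cong c≗d))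

-- Twin vertices

module Twins (G : SimpleGraph n) {v₁ v₂ : Fin n} (v₁≢v₂ : v₁ ≢ v₂) where

  open Counting G
  open GameValues G

  record Twin (c : Colouring n) : Set where
    field
      free₁      : c v₁ ≡ F
      free₂      : c v₂ ≡ F
      same-adj   : ∀ u → c u ≡ F → u ≢ v₁ → u ≢ v₂ → adj G v₁ u ≡ adj G v₂ u
      same-degL  : degL G c v₁ ≡ degL G c v₂
  open Twin

  pair pairᵒ : Colouring n → Colouring n
  pair  c = claim v₂ R (claim v₁ L c)
  pairᵒ c = claim v₁ R (claim v₂ L c)

  private
    v₂≢v₁ : v₂ ≢ v₁
    v₂≢v₁ = v₁≢v₂ ∘ sym

  twin-claim : Twin c → c y ≡ F → y ≢ v₁ → y ≢ v₂ → o ≢ F → Twin (claim y o c)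
  twin-claim {c = c} {y} {o} tw cy y≢v₁ y≢v₂ o≢F = record
    { free₁     = claim-free⁺ (free₁ tw) (y≢v₁ ∘ sym)
    ; free₂     = claim-free⁺ (free₂ tw) (y≢v₂ ∘ sym)
    ; same-adj  = λ u free → same-adj tw u (proj₂ (claim-free⁻ c y free o≢F))
    ; same-degL = degL-after o o≢F
    }
    where
    degL-after : ∀ o → o ≢ F → degL G (claim y o c) v₁ ≡ degL G (claim y o c) v₂
    degL-after L _ = begin
      degL G (claim y L c) v₁          ≡⟨ degL-claimL cy ⟩
      degL G c v₁ + b2n (adj G v₁ y)   ≡⟨ cong₂ (λ d a → d + b2n a)
                                                (same-degL tw) (same-adj tw y cy y≢v₁ y≢v₂) ⟩
      degL G c v₂ + b2n (adj G v₂ y)   ≡⟨ degL-claimL cy ⟨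
      degL G (claim y L c) v₂          ∎
      where open ≡-Reasoning
    degL-after R _ = trans (degL-claimR cy) (trans (same-degL tw) (sym (degL-claimR cy)))
    degL-after F F≢F = contradiction refl F≢F

  pair-free⁻ : pair c y ≡ F → c y ≡ F × y ≢ v₁ × y ≢ v₂
  pair-free⁻ {c = c} free with claim-free⁻ (claim v₁ L c) v₂ free R≢F
  ... | y≢v₂ , free′ with claim-free⁻ c v₁ free′ L≢F
  ...   | y≢v₁ , cy = cy , y≢v₁ , y≢v₂

  pair-free⁺ : c y ≡ F → y ≢ v₁ → y ≢ v₂ → pair c y ≡ F
  pair-free⁺ cy y≢v₁ y≢v₂ = claim-free⁺ (claim-free⁺ cy y≢v₁) y≢v₂

  isF-pair : ∀ v → isF (pair c v) ≡ isF (pairᵒ c v)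
  isF-pair {c = c} v = by-cases (v ≟ v₁) (v ≟ v₂)
    where
    by-cases : Dec (v ≡ v₁) → Dec (v ≡ v₂) → isF (pair c v) ≡ isF (pairᵒ c v)
    by-cases (yes refl) (yes refl) = contradiction refl v₁≢v₂
    by-cases (yes refl) (no v≢v₂)  =
      trans (cong isF (trans (claim-other R _ v≢v₂) (claim-self v L c)))
            (sym (cong isF (claim-self v R _)))
    by-cases (no v≢v₁)  (yes refl) =
      trans (cong isF (claim-self v R _))
            (sym (cong isF (trans (claim-other R _ v≢v₁) (claim-self v L c))))
    by-cases (no v≢v₁)  (no v≢v₂)  =
      cong isF (trans (trans (claim-other R _ v≢v₂) (claim-other L c v≢v₁))
                      (sym (trans (claim-other R _ v≢v₁) (claim-other L c v≢v₂))))

  edgesInL-pair : Twin c → edgesInL G (pair c) ≡ edgesInL G (pairᵒ c)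
  edgesInL-pair {c = c} tw = begin
    edgesInL G (pair c)          ≡⟨ edgesInL-claimR (claim-free⁺ (free₂ tw) v₂≢v₁) ⟩
    edgesInL G (claim v₁ L c)    ≡⟨ edgesInL-claimL c v₁ (cong isL (free₁ tw)) ⟩
    edgesInL G c + degL G c v₁   ≡⟨ cong (edgesInL G c +_) (same-degL tw) ⟩
    edgesInL G c + degL G c v₂   ≡⟨ edgesInL-claimL c v₂ (cong isL (free₂ tw)) ⟨
    edgesInL G (claim v₂ L c)    ≡⟨ edgesInL-claimR (claim-free⁺ (free₁ tw) v₁≢v₂) ⟨
    edgesInL G (pairᵒ c)         ∎
    where open ≡-Reasoning

  pair-swap : Twin c → SameValues (pair c) (pairᵒ c)
  pair-swap {c = c} = claim-induction (λ c → Twin c → SameValues (pair c) (pairᵒ c)) step c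
    where
    step : ∀ c → (∀ y o → c y ≡ F → o ≢ F → Twin (claim y o c) →
                  SameValues (pair (claim y o c)) (pairᵒ (claim y o c))) →
           Twin c → SameValues (pair c) (pairᵒ c)
    step c ih tw = values-cong isF-pair (edgesInL-pair tw) move
      where
      move : ∀ y o → pair c y ≡ F → o ≢ F → SameValues (claim y o (pair c)) (claim y o (pairᵒ c))
      move y o free o≢F with pair-free⁻ free
      ... | cy , y≢v₁ , y≢v₂ =
        SameValues-trans (values-ext (claim-comm₂ L R c y≢v₁ y≢v₂))
          (SameValues-trans (ih y o cy o≢F (twin-claim tw cy y≢v₁ y≢v₂ o≢F))
            (SameValues-sym (values-ext (claim-comm₂ L R c y≢v₂ y≢v₁))))

  module _ (c : Colouring n) (tw : Twin c)
           (elsewhere : ∀ {y} o → c y ≡ F → y ≢ v₁ → y ≢ v₂ → o ≢ F →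
                        SameValues (claim y o c) (claim y o (pair c))) where
    private
      pair-comm : SameValues (claim v₁ L (claim v₂ R c)) (pair c)
      pair-comm = values-ext (claim-comm L R c v₁≢v₂)

      pairᵒ-comm : SameValues (claim v₂ L (claim v₁ R c)) (pairᵒ c)
      pairᵒ-comm = values-ext (claim-comm L R c v₂≢v₁)

      only-v₂ : ¬ ∃ (λ z → pair c z ≡ F) → ∀ z → claim v₁ L c z ≡ F → z ≡ v₂
      only-v₂ none z free with claim-free⁻ c v₁ free L≢F | z ≟ v₂
      ... | _          | yes z≡v₂ = z≡v₂
      ... | z≢v₁ , cz  | no z≢v₂  = contradiction (z , pair-free⁺ cz z≢v₁ z≢v₂) none

      only-v₁ : ¬ ∃ (λ z → pair c z ≡ F) → ∀ z → claim v₂ R c z ≡ F → z ≡ v₁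
      only-v₁ none z free with claim-free⁻ c v₂ free R≢F | z ≟ v₁
      ... | _          | yes z≡v₁ = z≡v₁
      ... | z≢v₂ , cz  | no z≢v₁  = contradiction (z , pair-free⁺ cz z≢v₁ z≢v₂) none

    Ls≤Ls-pair : Ls G c ≤ Ls G (pair c)
    Ls≤Ls-pair = Ls-lub (free₁ tw) move
      where
      open ≤-Reasoning
      move : ∀ z → c z ≡ F → Rs G (claim z L c) ≤ Ls G (pair c)
      move z cz with z ≟ v₁ | z ≟ v₂
      ... | yes refl | _        = Rs-lb (claim-free⁺ (free₂ tw) v₂≢v₁)
      ... | no _     | yes refl = begin
        Rs G (claim v₂ L c)   ≤⟨ Rs-lb (claim-free⁺ (free₁ tw) v₁≢v₂) ⟩
        Ls G (pairᵒ c)        ≡⟨ proj₁ (pair-swap tw) ⟨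
        Ls G (pair c)         ∎
      ... | no z≢v₁  | no z≢v₂  = begin
        Rs G (claim z L c)         ≡⟨ proj₂ (elsewhere L cz z≢v₁ z≢v₂ L≢F) ⟩
        Rs G (claim z L (pair c))  ≤⟨ Ls-ub (pair-free⁺ cz z≢v₁ z≢v₂) ⟩
        Ls G (pair c)              ∎

    Ls-pair≤Ls : Ls G (pair c) ≤ Ls G c
    Ls-pair≤Ls with any? (λ y → free? (pair c y))
    ... | yes (y , free) = Ls-lub {y = y} free move
      where
      open ≤-Reasoning
      move : ∀ z → pair c z ≡ F → Rs G (claim z L (pair c)) ≤ Ls G c
      move z free with pair-free⁻ free
      ... | cz , z≢v₁ , z≢v₂ = begin
        Rs G (claim z L (pair c))  ≡⟨ proj₂ (elsewhere L cz z≢v₁ z≢v₂ L≢F) ⟨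
        Rs G (claim z L c)         ≤⟨ Ls-ub cz ⟩
        Ls G c                     ∎
    -- If v₁ and v₂ are the last free vertices, Right's answer v₂ to v₁ is forced.
    ... | no none = ≤-trans (Rs-glb {y = v₂} (claim-free⁺ (free₂ tw) v₂≢v₁) reply) (Ls-ub (free₁ tw))
      where
      reply : ∀ z → claim v₁ L c z ≡ F → Ls G (pair c) ≤ Ls G (claim z R (claim v₁ L c))
      reply z free with only-v₂ none z free
      ... | refl = ≤-refl

    Rs-pair≤Rs : Rs G (pair c) ≤ Rs G c
    Rs-pair≤Rs = Rs-glb (free₁ tw) move
      where
      open ≤-Reasoning
      move : ∀ z → c z ≡ F → Rs G (pair c) ≤ Ls G (claim z R c)
      move z cz with z ≟ v₁ | z ≟ v₂
      ... | yes refl | _        = begin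
        Rs G (pair c)                     ≡⟨ proj₂ (pair-swap tw) ⟩
        Rs G (pairᵒ c)                    ≡⟨ proj₂ pairᵒ-comm ⟨
        Rs G (claim v₂ L (claim v₁ R c))  ≤⟨ Ls-ub (claim-free⁺ (free₂ tw) v₂≢v₁) ⟩
        Ls G (claim v₁ R c)               ∎
      ... | no _     | yes refl = begin
        Rs G (pair c)                     ≡⟨ proj₂ pair-comm ⟨
        Rs G (claim v₁ L (claim v₂ R c))  ≤⟨ Ls-ub (claim-free⁺ (free₁ tw) v₁≢v₂) ⟩
        Ls G (claim v₂ R c)               ∎
      ... | no z≢v₁  | no z≢v₂  = begin
        Rs G (pair c)              ≤⟨ Rs-lb (pair-free⁺ cz z≢v₁ z≢v₂) ⟩
        Ls G (claim z R (pair c))  ≡⟨ proj₁ (elsewhere R cz z≢v₁ z≢v₂ R≢F) ⟨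
        Ls G (claim z R c)         ∎

    Rs≤Rs-pair : Rs G c ≤ Rs G (pair c)
    Rs≤Rs-pair with any? (λ y → free? (pair c y))
    ... | yes (y , free) = Rs-glb {y = y} free move
      where
      open ≤-Reasoning
      move : ∀ z → pair c z ≡ F → Rs G c ≤ Ls G (claim z R (pair c))
      move z free with pair-free⁻ free
      ... | cz , z≢v₁ , z≢v₂ = begin
        Rs G c                     ≤⟨ Rs-lb cz ⟩
        Ls G (claim z R c)         ≡⟨ proj₁ (elsewhere R cz z≢v₁ z≢v₂ R≢F) ⟩
        Ls G (claim z R (pair c))  ∎
    -- If v₁ and v₂ are the last free vertices, Left's answer v₁ to v₂ is forced.
    ... | no none = ≤-trans (Rs-lb (free₂ tw)) (Ls-lub {y = v₁} (claim-free⁺ (free₁ tw) v₁≢v₂) reply)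
      where
      reply : ∀ z → claim v₂ R c z ≡ F → Rs G (claim z L (claim v₂ R c)) ≤ Rs G (pair c)
      reply z free with only-v₁ none z free
      ... | refl = ≤-reflexive (proj₂ pair-comm)

  pair-values : Twin c → SameValues c (pair c)
  pair-values {c = c} = claim-induction (λ c → Twin c → SameValues c (pair c)) step c
    where
    step : ∀ c → (∀ y o → c y ≡ F → o ≢ F → Twin (claim y o c) →
                  SameValues (claim y o c) (pair (claim y o c))) →
           Twin c → SameValues c (pair c)
    step c ih tw = ≤-antisym (Ls≤Ls-pair c tw elsewhere) (Ls-pair≤Ls c tw elsewhere)
                 , ≤-antisym (Rs≤Rs-pair c tw elsewhere) (Rs-pair≤Rs c tw elsewhere)
      where
      elsewhere : ∀ {y} o → c y ≡ F → y ≢ v₁ → y ≢ v₂ → o ≢ F →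
                  SameValues (claim y o c) (claim y o (pair c))
      elsewhere o cy y≢v₁ y≢v₂ o≢F =
        SameValues-trans (ih _ o cy o≢F (twin-claim tw cy y≢v₁ y≢v₂ o≢F))
                         (SameValues-sym (values-ext (claim-comm₂ L R c y≢v₁ y≢v₂)))

mainTheorem13 : ∀ {n} (G : SimpleGraph n) (c : Colouring n) (v₁ v₂ : Fin n) →
    c v₁ ≡ F → c v₂ ≡ F → ¬ (v₁ ≡ v₂) →
    (∀ u → ((adj G v₁ u ≡ true × c u ≡ F) × ¬ (u ≡ v₂))
           ⇔ ((adj G v₂ u ≡ true × c u ≡ F) × ¬ (u ≡ v₁))) →
    degL G c v₁ ≡ degL G c v₂ →
    (Ls G c ≡ Ls G (claim v₂ R (claim v₁ L c)))
      × (Rs G c ≡ Rs G (claim v₂ R (claim v₁ L c)))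
mainTheorem13 G c v₁ v₂ free₁ free₂ v₁≢v₂ same-free-nbrs same-degL =
  pair-values record
    { free₁ = free₁ ; free₂ = free₂ ; same-adj = same-adj ; same-degL = same-degL }
  where
  open Twins G v₁≢v₂
  same-adj : ∀ u → c u ≡ F → u ≢ v₁ → u ≢ v₂ → adj G v₁ u ≡ adj G v₂ u
  same-adj u cu u≢v₁ u≢v₂ = ⇔→≡ {z = true} (mk⇔
    (λ e → proj₁ (proj₁ (Equivalence.to   (same-free-nbrs u) ((e , cu) , u≢v₂))))
    (λ e → proj₁ (proj₁ (Equivalence.from (same-free-nbrs u) ((e , cu) , u≢v₁)))))
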